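{- Let $G$ be a bipartite graph and let $S\subseteq V(G)$. Then \[ \operatorname{per}\bigl(L_G[S]\circ L_G[S]\bigr)\ \le\ \bigl(\operatorname{per}(L_G[S])\bigr)^2. \] In particular, for every $v\in V(G)$, \[ \operatorname{per}\bigl(L_G(v)\circ L_G(v)\bigr)\ \le\ \bigl(\operatorname{per}(L_G(v))\bigr)^2. \]
   Context: Graphs are simple. $L_G=D_G-A_G$ is the Laplacian (degree matrix minus adjacency matrix). For $S\subseteq V(G)$, $L_G[S]$ is the principal submatrix of $L_G$ with rows and columns indexed by $S$; $L_G(v)$ is the principal submatrix obtained by deleting the row and column indexed by $v$. $\operatorname{per}$ is the permanent and $\circ$ the Hadamard (entrywise) product. -}

module Defs where

open import Data.Nat using (ℕ; zero; suc)
open import Data.Bool using (Bool; true; false; if_then_else_; not)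
open import Data.Fin using (Fin; zero; suc; punchIn; _≟_)
open import Relation.Nullary using (yes; no)
open import Data.Product using (Σ)
open import Data.Fin.Subset using (Subset; inside; outside; ∣_∣)
open import Data.Vec using (Vec; []; _∷_)
open import Data.Integer using (ℤ; +_; _+_; _-_; _*_; -_; 0ℤ; 1ℤ)
open import Relation.Binary.PropositionalEquality using (_≡_; _≢_)

record Graph (n : ℕ) : Set where
  field
    adj     : Fin n → Fin n → Bool
    symm    : ∀ i j → adj i j ≡ adj j i
    irrefl  : ∀ i → adj i i ≡ false

open Graph public

IsBipartite : ∀ {n} → Graph n → Set
IsBipartite {n} G =
  Σ (Fin n → Bool) (λ c → ∀ i j → adj G i j ≡ true → c i ≢ c j)

sumFin : ∀ k → (Fin k → ℤ) → ℤ
sumFin zero    f = 0ℤ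
sumFin (suc k) f = f zero + sumFin k (λ i → f (suc i))

Matrix : ℕ → Set
Matrix k = Fin k → Fin k → ℤ

adjMatrix : ∀ {n} → Graph n → Matrix n
adjMatrix G i j = if adj G i j then 1ℤ else 0ℤ

degree : ∀ {n} → Graph n → Fin n → ℤ
degree {n} G i = sumFin n (adjMatrix G i)

degMatrix : ∀ {n} → Graph n → Matrix n
degMatrix G i j with i ≟ j
... | yes _ = degree G i
... | no _  = 0ℤ

laplacian : ∀ {n} → Graph n → Matrix n
laplacian G i j = degMatrix G i j - adjMatrix G i j

minor : ∀ {k} → Matrix (suc k) → Fin (suc k) → Matrix k
minor M j r c = M (suc r) (punchIn j c)

per : ∀ {k} → Matrix k → ℤ
per {zero}  M = 1ℤ
per {suc k} M = sumFin (suc k) (λ j → M zero j * per (minor M j))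

infixl 7 _∘ₕ_
_∘ₕ_ : ∀ {k} → Matrix k → Matrix k → Matrix k
(A ∘ₕ B) i j = A i j * B i j

elements : ∀ {n} (S : Subset n) → Fin ∣ S ∣ → Fin n
elements {suc n} (outside ∷ S) i       = suc (elements S i)
elements {suc n} (inside  ∷ S) zero    = zero
elements {suc n} (inside  ∷ S) (suc i) = suc (elements S i)

principal : ∀ {n} → Matrix n → (S : Subset n) → Matrix ∣ S ∣
principal M S i j = M (elements S i) (elements S j)

deleteRC : ∀ {n} → Matrix (suc n) → Fin (suc n) → Matrix n
deleteRC M v i j = M (punchIn v i) (punchIn v j)

{-# OPTIONS --safe #-}
module Submission where

-- Colour the two sides of G by s = ±1 and put S = diag s. Then S L S is the signless Laplacian D + A,
-- which is entrywise nonnegative, and this passes to principal submatrices. Conjugating by S scales the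
-- permanent by (∏ s)² = 1 and leaves M ∘ₕ M unchanged, so it suffices to show per (N ∘ₕ N) ≤ (per N)²
-- for nonnegative N: the terms of per (N ∘ₕ N) are the squares of the (nonnegative) terms of per N.

open import Defs
open import Data.Nat using (ℕ; suc; zero; z≤n)
open import Data.Bool using (Bool; true; false)
open import Data.Fin using (Fin; zero; suc; punchIn; _≟_)
open import Data.Fin.Subset using (Subset)
open import Data.Product using (_×_; _,_)
open import Data.Integer using (ℤ; _≤_; _*_; _+_; -_; 0ℤ; 1ℤ; -1ℤ; +≤+; nonNegative)
open import Data.Integer.Properties
  using (≤-refl; +-mono-≤; +-monoʳ-≤; i≤i+j; *-monoˡ-≤-nonNeg; *-zeroʳ;
         *-identityˡ; +-identityˡ; +-identityʳ; *-distribˡ-+; *-commutativeSemigroup; *-1-commutativeMonoid;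
         module ≤-Reasoning)
open import Data.Integer.Tactic.RingSolver using (solve-∀)
open import Algebra.Properties.CommutativeSemigroup *-commutativeSemigroup using (interchange)
open import Algebra.Properties.CommutativeMonoid.Sum *-1-commutativeMonoid
  using () renaming (sum to ∏; sum-remove to ∏-removeAt; ∑-distrib-+ to ∏-distrib-*;
                     sum-cong-≗ to ∏-cong; sum-replicate-zero to ∏-replicate-1)
open import Relation.Nullary using (Dec; yes; no; contradiction)
open import Relation.Binary.PropositionalEquality
open import Function using (_∘_)

sumFin-cong : ∀ k {f g : Fin k → ℤ} → (∀ i → f i ≡ g i) → sumFin k f ≡ sumFin k g
sumFin-cong zero    f≗g = refl
sumFin-cong (suc k) f≗g = cong₂ _+_ (f≗g zero) (sumFin-cong k (f≗g ∘ suc))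

sumFin-mono-≤ : ∀ k {f g : Fin k → ℤ} → (∀ i → f i ≤ g i) → sumFin k f ≤ sumFin k g
sumFin-mono-≤ zero    f≤g = ≤-refl
sumFin-mono-≤ (suc k) f≤g = +-mono-≤ (f≤g zero) (sumFin-mono-≤ k (f≤g ∘ suc))

sumFin-nonNeg : ∀ k {f : Fin k → ℤ} → (∀ i → 0ℤ ≤ f i) → 0ℤ ≤ sumFin k f
sumFin-nonNeg zero    f≥0 = ≤-refl
sumFin-nonNeg (suc k) f≥0 = +-mono-≤ (f≥0 zero) (sumFin-nonNeg k (f≥0 ∘ suc))

*-distribˡ-sumFin : ∀ k a (f : Fin k → ℤ) → a * sumFin k f ≡ sumFin k (λ i → a * f i)
*-distribˡ-sumFin zero    a f = *-zeroʳ a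
*-distribˡ-sumFin (suc k) a f = begin
  a * (f zero + sumFin k (f ∘ suc))           ≡⟨ *-distribˡ-+ a (f zero) _ ⟩
  a * f zero + a * sumFin k (f ∘ suc)         ≡⟨ cong (a * f zero +_) (*-distribˡ-sumFin k a (f ∘ suc)) ⟩
  a * f zero + sumFin k (λ i → a * f (suc i)) ∎
  where open ≡-Reasoning

*-nonNeg : ∀ {a b} → 0ℤ ≤ a → 0ℤ ≤ b → 0ℤ ≤ a * b
*-nonNeg {a} {b} a≥0 b≥0 = begin
  0ℤ     ≡⟨ *-zeroʳ a ⟨
  a * 0ℤ ≤⟨ *-monoˡ-≤-nonNeg a {{nonNegative a≥0}} b≥0 ⟩
  a * b  ∎
  where open ≤-Reasoning

sumFin-squares≤square : ∀ k {x : Fin k → ℤ} → (∀ i → 0ℤ ≤ x i) →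
  sumFin k (λ i → x i * x i) ≤ sumFin k x * sumFin k x
sumFin-squares≤square zero    x≥0 = ≤-refl
sumFin-squares≤square (suc k) {x} x≥0 = begin
  a * a + sumFin k (λ i → x (suc i) * x (suc i))
    ≤⟨ +-monoʳ-≤ (a * a) (sumFin-squares≤square k (x≥0 ∘ suc)) ⟩
  a * a + t * t
    ≤⟨ i≤i+j (a * a + t * t) (a * t + a * t) {{nonNegative 2at≥0}} ⟩
  a * a + t * t + (a * t + a * t)
    ≡⟨ square-of-sum a t ⟩
  (a + t) * (a + t) ∎
  where
  open ≤-Reasoning
  a = x zero
  t = sumFin k (x ∘ suc)
  at≥0 : 0ℤ ≤ a * t
  at≥0 = *-nonNeg (x≥0 zero) (sumFin-nonNeg k (x≥0 ∘ suc))
  2at≥0 : 0ℤ ≤ a * t + a * t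
  2at≥0 = +-mono-≤ at≥0 at≥0
  square-of-sum : ∀ a t → a * a + t * t + (a * t + a * t) ≡ (a + t) * (a + t)
  square-of-sum = solve-∀

∏-squares≡1 : ∀ k (s : Fin k → ℤ) → (∀ i → s i * s i ≡ 1ℤ) → ∏ s * ∏ s ≡ 1ℤ
∏-squares≡1 k s s²≡1 = begin
  ∏ s * ∏ s               ≡⟨ ∏-distrib-* s s ⟨
  ∏ {k} (λ i → s i * s i) ≡⟨ ∏-cong s²≡1 ⟩
  ∏ {k} (λ _ → 1ℤ)        ≡⟨ ∏-replicate-1 k ⟩
  1ℤ                      ∎
  where open ≡-Reasoning

per-cong : ∀ {k} {A B : Matrix k} → (∀ i j → A i j ≡ B i j) → per A ≡ per B
per-cong {zero}  A≗B = refl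
per-cong {suc k} A≗B = sumFin-cong (suc k) λ j →
  cong₂ _*_ (A≗B zero j) (per-cong λ a b → A≗B (suc a) (punchIn j b))

per-nonNeg : ∀ {k} {M : Matrix k} → (∀ i j → 0ℤ ≤ M i j) → 0ℤ ≤ per M
per-nonNeg {zero}  M≥0 = +≤+ z≤n
per-nonNeg {suc k} M≥0 = sumFin-nonNeg (suc k) λ j →
  *-nonNeg (M≥0 zero j) (per-nonNeg λ a b → M≥0 (suc a) (punchIn j b))

per-∘ₕ-self≤per² : ∀ {k} {M : Matrix k} → (∀ i j → 0ℤ ≤ M i j) → per (M ∘ₕ M) ≤ per M * per M
per-∘ₕ-self≤per² {zero}  M≥0 = ≤-refl
per-∘ₕ-self≤per² {suc k} {M} M≥0 = begin
  sumFin (suc k) (λ j → M zero j * M zero j * per (minor M j ∘ₕ minor M j))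
    ≤⟨ sumFin-mono-≤ (suc k) (λ j →
         *-monoˡ-≤-nonNeg _ {{nonNegative (*-nonNeg (M≥0 zero j) (M≥0 zero j))}}
           (per-∘ₕ-self≤per² (minor≥0 j))) ⟩
  sumFin (suc k) (λ j → M zero j * M zero j * (per (minor M j) * per (minor M j)))
    ≡⟨ sumFin-cong (suc k) (λ j → interchange (M zero j) (M zero j) (per (minor M j)) (per (minor M j))) ⟩
  sumFin (suc k) (λ j → term j * term j)
    ≤⟨ sumFin-squares≤square (suc k) (λ j → *-nonNeg (M≥0 zero j) (per-nonNeg (minor≥0 j))) ⟩
  per M * per M ∎
  where
  open ≤-Reasoning
  minor≥0 : ∀ j a b → 0ℤ ≤ minor M j a b
  minor≥0 j a b = M≥0 (suc a) (punchIn j b)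
  term : Fin (suc k) → ℤ
  term j = M zero j * per (minor M j)

per-scale : ∀ {k} (r c : Fin k → ℤ) (M : Matrix k) →
  per (λ i j → r i * c j * M i j) ≡ ∏ r * ∏ c * per M
per-scale {zero}  r c M = refl
per-scale {suc k} r c M = begin
  sumFin (suc k) (λ j → r zero * c j * M zero j * per (λ a b → r (suc a) * c (punchIn j b) * minor M j a b))
    ≡⟨ sumFin-cong (suc k) scaled-term ⟩
  sumFin (suc k) (λ j → ∏ r * ∏ c * (M zero j * per (minor M j)))
    ≡⟨ *-distribˡ-sumFin (suc k) (∏ r * ∏ c) (λ j → M zero j * per (minor M j)) ⟨
  ∏ r * ∏ c * per M ∎
  where
  open ≡-Reasoning
  regroup : ∀ a b m p q x → a * b * m * (p * q * x) ≡ a * p * (b * q) * (m * x)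
  regroup = solve-∀
  scaled-term : ∀ j → r zero * c j * M zero j * per (λ a b → r (suc a) * c (punchIn j b) * minor M j a b)
                    ≡ ∏ r * ∏ c * (M zero j * per (minor M j))
  scaled-term j = begin
    r zero * c j * M zero j * per (λ a b → r (suc a) * c (punchIn j b) * minor M j a b)
      ≡⟨ cong (r zero * c j * M zero j *_) (per-scale (r ∘ suc) (c ∘ punchIn j) (minor M j)) ⟩
    r zero * c j * M zero j * (∏ (r ∘ suc) * ∏ (c ∘ punchIn j) * per (minor M j))
      ≡⟨ regroup (r zero) (c j) (M zero j) (∏ (r ∘ suc)) (∏ (c ∘ punchIn j)) (per (minor M j)) ⟩
    ∏ r * (c j * ∏ (c ∘ punchIn j)) * (M zero j * per (minor M j))
      ≡⟨ cong (λ z → ∏ r * z * (M zero j * per (minor M j))) (∏-removeAt {i = j} c) ⟨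
    ∏ r * ∏ c * (M zero j * per (minor M j)) ∎

per-signature : ∀ {k} (s : Fin k → ℤ) (M : Matrix k) → (∀ i → s i * s i ≡ 1ℤ) →
  per (λ i j → s i * s j * M i j) ≡ per M
per-signature {k} s M s²≡1 = begin
  per (λ i j → s i * s j * M i j) ≡⟨ per-scale s s M ⟩
  ∏ s * ∏ s * per M               ≡⟨ cong (_* per M) (∏-squares≡1 k s s²≡1) ⟩
  1ℤ * per M                      ≡⟨ *-identityˡ (per M) ⟩
  per M                           ∎
  where open ≡-Reasoning

per-∘ₕ-self≤per²-signed : ∀ {k} (s : Fin k → ℤ) (M : Matrix k) → (∀ i → s i * s i ≡ 1ℤ) →
  (∀ i j → 0ℤ ≤ s i * s j * M i j) → per (M ∘ₕ M) ≤ per M * per M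
per-∘ₕ-self≤per²-signed s M s²≡1 SMS≥0 = begin
  per (M ∘ₕ M)      ≡⟨ per-cong (λ i j → sym (signed-square i j)) ⟩
  per (SMS ∘ₕ SMS)  ≤⟨ per-∘ₕ-self≤per² SMS≥0 ⟩
  per SMS * per SMS ≡⟨ cong₂ _*_ (per-signature s M s²≡1) (per-signature s M s²≡1) ⟩
  per M * per M     ∎
  where
  open ≤-Reasoning
  SMS : Matrix _
  SMS i j = s i * s j * M i j
  regroup : ∀ a b m → a * b * m * (a * b * m) ≡ a * a * (b * b) * (m * m)
  regroup = solve-∀
  signed-square : ∀ i j → SMS i j * SMS i j ≡ M i j * M i j
  signed-square i j rewrite regroup (s i) (s j) (M i j) | s²≡1 i | s²≡1 j = *-identityˡ _

sign : Bool → ℤ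
sign true  = 1ℤ
sign false = -1ℤ

sign-square : ∀ b → sign b * sign b ≡ 1ℤ
sign-square true  = refl
sign-square false = refl

sign-≢ : ∀ {b c} → b ≢ c → sign b * sign c ≡ -1ℤ
sign-≢ {true}  {true}  b≢c = contradiction refl b≢c
sign-≢ {true}  {false} b≢c = refl
sign-≢ {false} {true}  b≢c = refl
sign-≢ {false} {false} b≢c = contradiction refl b≢c

module _ {n : ℕ} (G : Graph n) where

  adjMatrix-nonNeg : ∀ i j → 0ℤ ≤ adjMatrix G i j
  adjMatrix-nonNeg i j with adj G i j
  ... | true  = +≤+ z≤n
  ... | false = +≤+ z≤n

  laplacian-diag : ∀ i → laplacian G i i ≡ degree G i
  laplacian-diag i with i ≟ i
  ... | yes _   rewrite irrefl G i = +-identityʳ (degree G i)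
  ... | no i≢i  = contradiction refl i≢i

  laplacian-offDiag : ∀ {i j} → i ≢ j → laplacian G i j ≡ - adjMatrix G i j
  laplacian-offDiag {i} {j} i≢j with i ≟ j
  ... | yes i≡j = contradiction i≡j i≢j
  ... | no _    = +-identityˡ (- adjMatrix G i j)

  laplacian-signed-nonNeg : (colour : Fin n → Bool) →
    (∀ i j → adj G i j ≡ true → colour i ≢ colour j) →
    ∀ i j → 0ℤ ≤ sign (colour i) * sign (colour j) * laplacian G i j
  laplacian-signed-nonNeg colour proper i j = by-cases (i ≟ j)
    where
    open ≤-Reasoning
    by-cases : Dec (i ≡ j) → 0ℤ ≤ sign (colour i) * sign (colour j) * laplacian G i j
    by-cases (yes refl) = begin
      0ℤ                                                  ≤⟨ sumFin-nonNeg n (adjMatrix-nonNeg i) ⟩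
      degree G i                                          ≡⟨ laplacian-diag i ⟨
      laplacian G i i                                     ≡⟨ *-identityˡ (laplacian G i i) ⟨
      1ℤ * laplacian G i i                                ≡⟨ cong (_* laplacian G i i) (sign-square (colour i)) ⟨
      sign (colour i) * sign (colour i) * laplacian G i i ∎
    by-cases (no i≢j) rewrite laplacian-offDiag i≢j with adj G i j in adjacent
    ... | false rewrite *-zeroʳ (sign (colour i) * sign (colour j)) = +≤+ z≤n
    ... | true  rewrite sign-≢ (proper i j adjacent) = +≤+ z≤n

submatrix : ∀ {n k} → Matrix n → (Fin k → Fin n) → Matrix k
submatrix M e i j = M (e i) (e j)

bipartite-laplacian-submatrix : ∀ {n k} (G : Graph n) → IsBipartite G → (e : Fin k → Fin n) →
  per (submatrix (laplacian G) e ∘ₕ submatrix (laplacian G) e)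
    ≤ per (submatrix (laplacian G) e) * per (submatrix (laplacian G) e)
bipartite-laplacian-submatrix G (colour , proper) e =
  per-∘ₕ-self≤per²-signed (sign ∘ colour ∘ e) (submatrix (laplacian G) e)
    (λ i → sign-square (colour (e i)))
    (λ i j → laplacian-signed-nonNeg G colour proper (e i) (e j))

corollary3p3 : (∀ (n : ℕ) (G : Graph n) → IsBipartite G → (S : Subset n) →
    per (principal (laplacian G) S ∘ₕ principal (laplacian G) S)
      ≤ per (principal (laplacian G) S) * per (principal (laplacian G) S))
  × (∀ (n : ℕ) (G : Graph (suc n)) → IsBipartite G → (v : Fin (suc n)) →
    per (deleteRC (laplacian G) v ∘ₕ deleteRC (laplacian G) v)
      ≤ per (deleteRC (laplacian G) v) * per (deleteRC (laplacian G) v))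
corollary3p3 =
  (λ n G bipartite S → bipartite-laplacian-submatrix G bipartite (elements S)) ,
  (λ n G bipartite v → bipartite-laplacian-submatrix G bipartite (punchIn v))
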